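{- Let $p$ be a prime, let $q \ge 2$ be an integer coprime to $p$, and let $n \ge 1$. Let $R = F_p[x_1,\ldots,x_n]/(x_1^2 - x_1,\ldots,x_n^2 - x_n)$, let $\chi_q \in R$ be the function with $\chi_q(x) = 1$ if $q$ divides $|x| = x_1+\cdots+x_n$ and $\chi_q(x) = 0$ otherwise, and let $\neg\chi_q = 1 - \chi_q$. Then the immunity of $\neg \chi_q$ over $F_p$, i.e. the minimum degree of a nonzero element of the ideal $\langle \neg\chi_q\rangle$ of $R$, equals $\lfloor (n+q-1)/q \rfloor$ (in particular it does not depend on $p$).
   Context: Every element of $R$ has a unique multilinear polynomial representative, and $R$ is identified with the algebra of functions $\{0,1\}^n \to F_p$. The degree of an element of $R$ is the degree of its multilinear representative. $\langle g\rangle$ denotes the ideal of $R$ generated by $g$. -}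

module Defs where

open import Data.Nat using (ℕ; zero; suc; _+_; _*_; _∸_; _≤_; _<_; NonZero)
open import Data.Nat.DivMod using (_mod_; _/_)
open import Data.Nat.Divisibility using (_∣_; _∣?_)
open import Data.Nat.Primality using (Prime; prime⇒nonZero)
open import Data.Fin using (Fin; toℕ)
open import Data.Bool using (Bool; true; false; if_then_else_)
open import Data.Vec using (Vec; []; _∷_)
open import Data.Product using (Σ; _×_; ∃)
open import Relation.Nullary using (¬_; Dec; yes; no)
open import Relation.Binary.PropositionalEquality using (_≡_)

Cube : ℕ → Set
Cube n = Vec Bool n

weight : ∀ {n} → Cube n → ℕ
weight []          = 0
weight (false ∷ x) = weight x
weight (true  ∷ x) = suc (weight x)

sumCube : ∀ {A : Set} (_⊕_ : A → A → A) (e : A) n → (Cube n → A) → A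
sumCube _⊕_ e zero    f = f []
sumCube _⊕_ e (suc n) f =
  sumCube _⊕_ e n (λ x → f (false ∷ x)) ⊕ sumCube _⊕_ e n (λ x → f (true ∷ x))

-- Monomial x^S = ∏_{i ∈ S} x_i, for S ⊆ [n] given as its indicator vector.
monomial : ∀ {n} → Cube n → Cube n → Bool
monomial []          []          = true
monomial (false ∷ S) (_ ∷ x)     = monomial S x
monomial (true  ∷ S) (b ∷ x)     = if b then monomial S x else false

2≤⇒nonZero : ∀ {q} → 2 ≤ q → NonZero q
2≤⇒nonZero (Data.Nat.s≤s _) = _

floorDiv : (a q : ℕ) → 2 ≤ q → ℕ
floorDiv a q h = _/_ a q {{2≤⇒nonZero h}}

module Field (p : ℕ) (pr : Prime p) where
  instance
    nz : NonZero p
    nz = prime⇒nonZero pr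

  Fp : Set
  Fp = Fin p

  0F 1F : Fp
  0F = 0 mod p
  1F = 1 mod p

  _+F_ _*F_ _-F_ : Fp → Fp → Fp
  a +F b = (toℕ a + toℕ b) mod p
  a *F b = (toℕ a * toℕ b) mod p
  a -F b = (toℕ a + (p ∸ toℕ b)) mod p

  -- R = F_p[x₁,…,xₙ]/(xᵢ² − xᵢ), identified with functions {0,1}^n → F_p.
  R : ℕ → Set
  R n = Cube n → Fp

  _*R_ : ∀ {n} → R n → R n → R n
  (f *R g) x = f x *F g x

  1R : ∀ {n} → R n
  1R _ = 1F

  _-R_ : ∀ {n} → R n → R n → R n
  (f -R g) x = f x -F g x

  Nonzero : ∀ {n} → R n → Set
  Nonzero f = ¬ (∀ x → f x ≡ 0F)

  evalML : ∀ {n} → (Cube n → Fp) → Cube n → Fp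
  evalML {n} c x = sumCube _+F_ 0F n (λ S → if monomial S x then c S else 0F)

  -- deg f ≤ d : the (unique) multilinear representative of f has all
  -- nonzero coefficients on monomials x^S with |S| ≤ d.
  DegLE : ∀ {n} → R n → ℕ → Set
  DegLE {n} f d = Σ (Cube n → Fp) λ c →
    (∀ S → d < weight S → c S ≡ 0F) × (∀ x → evalML c x ≡ f x)

  InIdeal : ∀ {n} → R n → R n → Set
  InIdeal {n} g f = Σ (R n) λ h → ∀ x → f x ≡ (h *R g) x

  ImmunityIs : ∀ {n} → R n → ℕ → Set
  ImmunityIs {n} g m =
    (Σ (R n) λ f → InIdeal g f × Nonzero f × DegLE f m) ×
    (∀ (f : R n) → InIdeal g f → Nonzero f → ∀ d → DegLE f d → m ≤ d)

  chi : (q : ℕ) → ∀ {n} → R n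
  chi q x with q ∣? weight x
  ... | yes _ = 1F
  ... | no  _ = 0F

  notChi : (q : ℕ) → ∀ {n} → R n
  notChi q = 1R -R chi q

-- A function lies in ⟨¬χ_q⟩ exactly when it vanishes at every point whose weight is a multiple
-- of q, so both bounds are statements about such vanishing polynomials.
--
-- Lower bound: let f have degree ≤ d, coefficients supported on subsets of A, vanish at the points
-- x ⊆ A with q ∣ |x|, and suppose dq < |A|. Take a top coefficient c_S ≠ 0 and s ∈ S. Since q is
-- invertible mod p, some q-set B ⊆ A ∖ (S − s) has ∑_{j ∈ B} c_{(S − s) ∪ j} ≠ 0 (otherwise
-- exchanging elements of B for s would force q · c_S = 0). Then x ↦ f (x ∪ B) − f x on the subcube
-- A ∖ B has degree ≤ d − 1, still vanishes at multiples of q, and its coefficient at S − s is that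
-- nonzero sum. By induction on d, f = 0 whenever dq < n, i.e. every nonzero f has degree ≥ ⌈n/q⌉.
--
-- Upper bound: for n = m + 2 take f = (x₁ − x₂) · ∑_{j ≤ K} D_j e_j(y) with K = ⌊(m + 1)/q⌋. It
-- vanishes at multiples of q as soon as ∑_j (w choose j) D_j = 0 for the K weights w = rq − 1 ≤ m,
-- and these K linear conditions on K + 1 unknowns have a nonzero solution by counting.
-- For n = 1 take f = x₁.

module Submission where

open import Defs
open import Data.Nat using (ℕ; _+_; _∸_; _≤_)
open import Data.Nat.Primality using (Prime)
open import Data.Nat.Coprimality using (Coprime)
open import Data.Nat as ℕ using (zero; suc; _*_; _%_; _<_; _<?_; s≤s; z≤n; NonZero)
import Data.Nat.Properties as ℕ
open import Data.Nat.DivMod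
  using ( _mod_; _/_; m<n⇒m%n≡m; n%n≡0; m%n<n; %-distribˡ-+; %-distribˡ-*
        ; n/n≡1; m*n/n≡m; /-monoˡ-≤; m/n<m; +-distrib-/-∣ʳ; m<n*o⇒m/o<n)
open import Data.Nat.Divisibility using (_∣_; _∣?_; divides; ∣-refl; ∣⇒≤; m%n≡0⇒n∣m; ∣m∣n⇒∣m+n; _∣0)
open import Data.Nat.Primality using (prime⇒nonTrivial)
open import Data.Nat.Coprimality as Coprime using (coprime-divisor)
open import Data.Bool using (Bool; true; false; _∧_; _∨_; if_then_else_)
import Data.Bool.Properties as Bool
open import Data.Fin as Fin using (Fin; toℕ; _≟_; funToFin; finToFun; combine)
import Data.Fin.Properties as Fin
open import Data.Fin.Subset using (⁅_⁆; _∪_; _─_; _-_; ∁; _∈_; _∉_) renaming (⊥ to ∅; ⊤ to full)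
open import Data.Fin.Subset.Properties using (p─⊥≡p; ∪-identityˡ; ∪-identityʳ; ∪-comm; _∈?_; x∈p∧x∉q⇒x∈p─q)
open import Data.Vec using ([]; _∷_; here; there)
open import Data.Product using (Σ; ∃; ∃₂; _×_; _,_; proj₁; proj₂)
open import Data.Sum using (inj₁; inj₂)
open import Data.Empty using (⊥-elim)
open import Relation.Nullary using (¬_; Dec; yes; no; ¬?)
open import Relation.Nullary.Decidable using (_×-dec_)
open import Function using (_∘_)
open import Relation.Binary.PropositionalEquality
open import Algebra.Bundles using (CommutativeRing)
open import Algebra.Structures using (IsCommutativeRing)
open ≡-Reasoning

-- Subsets of the index set, as points of the cube

infix 4 _⊆_

_⊆_ : ∀ {n} → Cube n → Cube n → Set
S ⊆ x = monomial S x ≡ true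

⊆-refl : ∀ {n} (S : Cube n) → S ⊆ S
⊆-refl []          = refl
⊆-refl (false ∷ S) = ⊆-refl S
⊆-refl (true  ∷ S) = ⊆-refl S

⊆-trans : ∀ {n} (X Y Z : Cube n) → X ⊆ Y → Y ⊆ Z → X ⊆ Z
⊆-trans []          []          []          _  _  = refl
⊆-trans (false ∷ X) (false ∷ Y) (_ ∷ Z)     h₁ h₂ = ⊆-trans X Y Z h₁ h₂
⊆-trans (false ∷ X) (true ∷ Y)  (true ∷ Z)  h₁ h₂ = ⊆-trans X Y Z h₁ h₂
⊆-trans (true ∷ X)  (true ∷ Y)  (true ∷ Z)  h₁ h₂ = ⊆-trans X Y Z h₁ h₂

∅⊆ : ∀ {n} (x : Cube n) → ∅ ⊆ x
∅⊆ []      = refl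
∅⊆ (_ ∷ x) = ∅⊆ x

⊆full : ∀ {n} (S : Cube n) → S ⊆ full
⊆full []          = refl
⊆full (false ∷ S) = ⊆full S
⊆full (true  ∷ S) = ⊆full S

∈-⊆ : ∀ {n} {X Y : Cube n} {i} → X ⊆ Y → i ∈ X → i ∈ Y
∈-⊆ {X = true ∷ X}  {true ∷ Y} _ here      = here
∈-⊆ {X = false ∷ X} {_ ∷ Y}    h (there i) = there (∈-⊆ {X = X} h i)
∈-⊆ {X = true ∷ X}  {true ∷ Y} h (there i) = there (∈-⊆ {X = X} h i)

monomial-─ : ∀ {n} (U A B : Cube n) → monomial U (A ─ B) ≡ monomial U A ∧ monomial U (∁ B)
monomial-─ []          []          []          = refl
monomial-─ (false ∷ U) (_ ∷ A)     (_ ∷ B)     = monomial-─ U A B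
monomial-─ (true ∷ U)  (false ∷ A) (false ∷ B) = refl
monomial-─ (true ∷ U)  (false ∷ A) (true ∷ B)  = refl
monomial-─ (true ∷ U)  (true ∷ A)  (false ∷ B) = monomial-─ U A B
monomial-─ (true ∷ U)  (true ∷ A)  (true ∷ B)  = sym (Bool.∧-zeroʳ _)

monomial-∪ : ∀ {n} (T U A : Cube n) → monomial (T ∪ U) A ≡ monomial T A ∧ monomial U A
monomial-∪ []          []          []          = refl
monomial-∪ (false ∷ T) (false ∷ U) (_ ∷ A)     = monomial-∪ T U A
monomial-∪ (true ∷ T)  (_ ∷ U)     (false ∷ A) = refl
monomial-∪ (false ∷ T) (true ∷ U)  (false ∷ A) = sym (Bool.∧-zeroʳ _)
monomial-∪ (true ∷ T)  (false ∷ U) (true ∷ A)  = monomial-∪ T U A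
monomial-∪ (true ∷ T)  (true ∷ U)  (true ∷ A)  = monomial-∪ T U A
monomial-∪ (false ∷ T) (true ∷ U)  (true ∷ A)  = monomial-∪ T U A

∧≡true⁻ : ∀ {a b : Bool} → a ∧ b ≡ true → a ≡ true × b ≡ true
∧≡true⁻ {true} {true} _ = refl , refl

⊆-─⁻ : ∀ {n} (U A B : Cube n) → U ⊆ A ─ B → U ⊆ A × U ⊆ ∁ B
⊆-─⁻ U A B h = ∧≡true⁻ (trans (sym (monomial-─ U A B)) h)

⊆-∪⁺ : ∀ {n} (T U A : Cube n) → T ⊆ A → U ⊆ A → T ∪ U ⊆ A
⊆-∪⁺ T U A h₁ h₂ = trans (monomial-∪ T U A) (cong₂ _∧_ h₁ h₂)

disjoint-sym : ∀ {n} (B S : Cube n) → B ⊆ ∁ S → S ⊆ ∁ B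
disjoint-sym []          []          _ = refl
disjoint-sym (false ∷ B) (false ∷ S) h = disjoint-sym B S h
disjoint-sym (false ∷ B) (true ∷ S)  h = disjoint-sym B S h
disjoint-sym (true ∷ B)  (false ∷ S) h = disjoint-sym B S h

─-disjoint : ∀ {n} (x B : Cube n) → x ⊆ ∁ B → x ─ B ≡ x
─-disjoint []          []          _ = refl
─-disjoint (false ∷ x) (false ∷ B) h = cong (false ∷_) (─-disjoint x B h)
─-disjoint (true ∷ x)  (false ∷ B) h = cong (true ∷_) (─-disjoint x B h)
─-disjoint (false ∷ x) (true ∷ B)  h = cong (false ∷_) (─-disjoint x B h)

weight-∪ : ∀ {n} (T U B : Cube n) → T ⊆ B → U ⊆ ∁ B → weight (T ∪ U) ≡ weight T + weight U
weight-∪ []          []          []          _  _  = refl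
weight-∪ (false ∷ T) (false ∷ U) (_ ∷ B)     h₁ h₂ = weight-∪ T U B h₁ h₂
weight-∪ (true ∷ T)  (false ∷ U) (true ∷ B)  h₁ h₂ = cong suc (weight-∪ T U B h₁ h₂)
weight-∪ (false ∷ T) (true ∷ U)  (false ∷ B) h₁ h₂ =
  trans (cong suc (weight-∪ T U B h₁ h₂)) (sym (ℕ.+-suc (weight T) (weight U)))

weight-─ : ∀ {n} (A B : Cube n) → B ⊆ A → weight (A ─ B) + weight B ≡ weight A
weight-─ []          []          _ = refl
weight-─ (false ∷ A) (false ∷ B) h = weight-─ A B h
weight-─ (true ∷ A)  (false ∷ B) h = cong suc (weight-─ A B h)
weight-─ (true ∷ A)  (true ∷ B)  h = trans (ℕ.+-suc _ (weight B)) (cong suc (weight-─ A B h))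

weight-∅ : ∀ n → weight (∅ {n}) ≡ 0
weight-∅ zero    = refl
weight-∅ (suc n) = weight-∅ n

weight-full : ∀ n → weight (full {n}) ≡ n
weight-full zero    = refl
weight-full (suc n) = cong suc (weight-full n)

weight≤n : ∀ {n} (x : Cube n) → weight x ≤ n
weight≤n []          = z≤n
weight≤n (false ∷ x) = ℕ.m≤n⇒m≤1+n (weight≤n x)
weight≤n (true ∷ x)  = s≤s (weight≤n x)

weight≡0⇒∅ : ∀ {n} (S : Cube n) → weight S ≡ 0 → S ≡ ∅
weight≡0⇒∅ []          _ = refl
weight≡0⇒∅ (false ∷ S) h = cong (false ∷_) (weight≡0⇒∅ S h)

nonempty : ∀ {n} (S : Cube n) → 1 ≤ weight S → ∃ λ s → s ∈ S
nonempty (true ∷ S)  _ = Fin.zero , here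
nonempty (false ∷ S) h with nonempty S h
... | s , s∈S = Fin.suc s , there s∈S

subset-of-size : ∀ {n} k (A : Cube n) → k ≤ weight A → Σ (Cube n) λ B → B ⊆ A × weight B ≡ k
subset-of-size {n} zero A _ = ∅ , ∅⊆ A , weight-∅ n
subset-of-size (suc k) (false ∷ A) h with subset-of-size (suc k) A h
... | B , B⊆A , ∣B∣ = false ∷ B , B⊆A , ∣B∣
subset-of-size (suc k) (true ∷ A) (s≤s h) with subset-of-size k A h
... | B , B⊆A , ∣B∣ = true ∷ B , B⊆A , cong suc ∣B∣

⁅s⁆∪[S-s] : ∀ {n} {S : Cube n} {s} → s ∈ S → ⁅ s ⁆ ∪ (S - s) ≡ S
⁅s⁆∪[S-s] {S = true ∷ S} here = cong (true ∷_) (trans (∪-identityˡ (S ─ ∅)) (p─⊥≡p S))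
⁅s⁆∪[S-s] {S = b ∷ S} (there s∈S) = cong (b ∷_) (⁅s⁆∪[S-s] s∈S)

weight-remove : ∀ {n} {S : Cube n} {s} → s ∈ S → suc (weight (S - s)) ≡ weight S
weight-remove {S = true ∷ S} here = cong suc (cong weight (p─⊥≡p S))
weight-remove {S = false ∷ S} (there s∈S) = weight-remove s∈S
weight-remove {S = true ∷ S} (there s∈S) = cong suc (weight-remove s∈S)

weight-insert : ∀ {n} {S : Cube n} {s} → s ∉ S → weight (S ∪ ⁅ s ⁆) ≡ suc (weight S)
weight-insert {S = true ∷ S} {Fin.zero} s∉S = ⊥-elim (s∉S here)
weight-insert {S = false ∷ S} {Fin.zero} _ = cong suc (cong weight (∪-identityʳ S))
weight-insert {S = false ∷ S} {Fin.suc s} s∉S = weight-insert (s∉S ∘ there)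
weight-insert {S = true ∷ S} {Fin.suc s} s∉S = cong suc (weight-insert (s∉S ∘ there))

p-x⊆p : ∀ {n} (S : Cube n) s → S - s ⊆ S
p-x⊆p (_ ∷ S)     Fin.zero    = subst (_⊆ S) (sym (p─⊥≡p S)) (⊆-refl S)
p-x⊆p (false ∷ S) (Fin.suc s) = p-x⊆p S s
p-x⊆p (true ∷ S)  (Fin.suc s) = p-x⊆p S s

x∉p-x : ∀ {n} {S : Cube n} {s} → s ∉ S - s
x∉p-x {S = b ∷ S} {Fin.suc s} (there s∈) = x∉p-x s∈

insert-⊆ : ∀ {n} {B P : Cube n} {s} → B ⊆ P → s ∈ P → B ∪ ⁅ s ⁆ ⊆ P
insert-⊆ {B = false ∷ B} {true ∷ P} h here = subst (_⊆ P) (sym (∪-identityʳ B)) h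
insert-⊆ {B = true ∷ B}  {true ∷ P} h here = subst (_⊆ P) (sym (∪-identityʳ B)) h
insert-⊆ {B = false ∷ B} {_ ∷ P}    h (there s∈P) = insert-⊆ {B = B} h s∈P
insert-⊆ {B = true ∷ B}  {true ∷ P} h (there s∈P) = insert-⊆ {B = B} h s∈P

funToFin-cong : ∀ {m n} {f g : Fin m → Fin n} → (∀ x → f x ≡ g x) → funToFin f ≡ funToFin g
funToFin-cong {zero}  f≗g = refl
funToFin-cong {suc m} f≗g = cong₂ combine (f≗g Fin.zero) (funToFin-cong (f≗g ∘ Fin.suc))

function-pigeonhole : ∀ {m k} → 1 ℕ.< m → (L : (Fin (suc k) → Fin m) → (Fin k → Fin m)) →
  ∃₂ λ v w → (∃ λ i → v i ≢ w i) × (∀ r → L v r ≡ L w r)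
function-pigeonhole {m} {k} 1<m L with Fin.pigeonhole (ℕ.^-monoʳ-< m 1<m (ℕ.n<1+n k)) (funToFin ∘ L ∘ finToFun)
... | i , j , i<j , hi≡hj = v , w , differ , same
  where
  v = finToFun {m} {suc k} i
  w = finToFun {m} {suc k} j
  same : ∀ r → L v r ≡ L w r
  same r = trans (sym (Fin.finToFun-funToFin (L v) r))
                 (trans (cong (λ z → finToFun z r) hi≡hj) (Fin.finToFun-funToFin (L w) r))
  differ : ∃ λ x → v x ≢ w x
  differ with Fin.any? (λ x → ¬? (v x ≟ w x))
  ... | yes found = found
  ... | no ∄x = ⊥-elim (Fin.<-irrefl i≡j i<j)
    where
    v≗w : ∀ x → v x ≡ w x
    v≗w x with v x ≟ w x
    ... | yes eq = eq
    ... | no neq = ⊥-elim (∄x (x , neq))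
    i≡j : i ≡ j
    i≡j = trans (sym (Fin.funToFin-finToFin {suc k} {m} i))
                (trans (funToFin-cong v≗w) (Fin.funToFin-finToFin {suc k} {m} j))

[1+d]q<m+d⇒1+q≤m : ∀ d q {m a} .{{_ : NonZero q}} → m + d ≡ a → suc d * q < a → suc q ≤ m
[1+d]q<m+d⇒1+q≤m d q {m} refl lt = ℕ.+-cancelʳ-≤ d (suc q) m (ℕ.≤-trans (s≤s (ℕ.+-monoʳ-≤ q (ℕ.m≤m*n d q))) lt)

[1+d]q<m+q⇒dq<m : ∀ d q {m a} → m + q ≡ a → suc d * q < a → d * q < m
[1+d]q<m+q⇒dq<m d q {m} refl lt =
  ℕ.+-cancelʳ-≤ q (suc (d * q)) m (subst (_≤ m + q) (cong suc (ℕ.+-comm q (d * q))) lt)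

⌈/⌉-≤ : ∀ n d q .{{_ : NonZero q}} → n ≤ d * q → (n + q ∸ 1) / q ≤ d
⌈/⌉-≤ n d q@(suc q′) n≤dq = ℕ.≤-pred (m<n*o⇒m/o<n (subst (_< suc d * q) (sym (cong (_∸ 1) (ℕ.+-suc n q′)))
  (s≤s (ℕ.≤-trans (ℕ.≤-reflexive (ℕ.+-comm n q′)) (ℕ.+-monoʳ-≤ q′ n≤dq)))))

predecessor-of-multiple : ∀ {q w m} .{{_ : NonZero q}} → q ∣ suc w → w ≤ m →
  ∃ λ (r : Fin (suc m / q)) → suc (toℕ r) * q ∸ 1 ≡ w
predecessor-of-multiple {q} {w} {m} (divides (suc t) w+1≡[t+1]q) w≤m =
  Fin.fromℕ< t<m+1/q , trans (cong (λ r → suc r * q ∸ 1) (Fin.toℕ-fromℕ< t<m+1/q)) (cong (_∸ 1) (sym w+1≡[t+1]q))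
  where
  t<m+1/q : t < suc m / q
  t<m+1/q = ℕ.≤-trans (ℕ.≤-reflexive (sym (m*n/n≡m (suc t) q))) (/-monoˡ-≤ q (subst (_≤ suc m) w+1≡[t+1]q (s≤s w≤m)))

module _ (p : ℕ) (pr : Prime p) where

  open Field p pr

  π : ℕ → Fp
  π m = m mod p

  toℕ-π : ∀ m → toℕ (π m) ≡ m % p
  toℕ-π m = Fin.toℕ-fromℕ< (m%n<n m p)

  π-cong-% : ∀ {m n} → m % p ≡ n % p → π m ≡ π n
  π-cong-% {m} {n} e = Fin.toℕ-injective (trans (toℕ-π m) (trans e (sym (toℕ-π n))))

  π-toℕ : ∀ a → π (toℕ a) ≡ a
  π-toℕ a = Fin.toℕ-injective (trans (toℕ-π (toℕ a)) (m<n⇒m%n≡m (Fin.toℕ<n a)))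

  π-+ : ∀ m n → π m +F π n ≡ π (m + n)
  π-+ m n = π-cong-% (trans (cong₂ (λ u v → (u + v) % p) (toℕ-π m) (toℕ-π n)) (sym (%-distribˡ-+ m n p)))

  π-* : ∀ m n → π m *F π n ≡ π (m * n)
  π-* m n = π-cong-% (trans (cong₂ (λ u v → (u * v) % p) (toℕ-π m) (toℕ-π n)) (sym (%-distribˡ-* m n p)))

  negF : Fp → Fp
  negF b = π (p ∸ toℕ b)

  π-elim₁ : (P : Fp → Set) → (∀ m → P (π m)) → ∀ a → P a
  π-elim₁ P h a = subst P (π-toℕ a) (h (toℕ a))

  π-elim₂ : (P : Fp → Fp → Set) → (∀ m n → P (π m) (π n)) → ∀ a b → P a b
  π-elim₂ P h a b = subst₂ P (π-toℕ a) (π-toℕ b) (h (toℕ a) (toℕ b))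

  π-elim₃ : (P : Fp → Fp → Fp → Set) → (∀ m n o → P (π m) (π n) (π o)) → ∀ a b c → P a b c
  π-elim₃ P h a b c = π-elim₁ (P a b) (λ o → π-elim₂ (λ x y → P x y (π o)) (λ m n → h m n o) a b) c

  +F-assoc : ∀ a b c → (a +F b) +F c ≡ a +F (b +F c)
  +F-assoc = π-elim₃ _ λ m n o → begin
    (π m +F π n) +F π o ≡⟨ cong (_+F π o) (π-+ m n) ⟩
    π (m + n) +F π o    ≡⟨ π-+ _ _ ⟩
    π (m + n + o)       ≡⟨ cong π (ℕ.+-assoc m n o) ⟩
    π (m + (n + o))     ≡⟨ sym (π-+ _ _) ⟩
    π m +F π (n + o)    ≡⟨ cong (π m +F_) (sym (π-+ n o)) ⟩
    π m +F (π n +F π o) ∎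

  *F-assoc : ∀ a b c → (a *F b) *F c ≡ a *F (b *F c)
  *F-assoc = π-elim₃ _ λ m n o → begin
    (π m *F π n) *F π o ≡⟨ cong (_*F π o) (π-* m n) ⟩
    π (m * n) *F π o    ≡⟨ π-* _ _ ⟩
    π (m * n * o)       ≡⟨ cong π (ℕ.*-assoc m n o) ⟩
    π (m * (n * o))     ≡⟨ sym (π-* _ _) ⟩
    π m *F π (n * o)    ≡⟨ cong (π m *F_) (sym (π-* n o)) ⟩
    π m *F (π n *F π o) ∎

  +F-comm : ∀ a b → a +F b ≡ b +F a
  +F-comm = π-elim₂ _ λ m n → trans (π-+ m n) (trans (cong π (ℕ.+-comm m n)) (sym (π-+ n m)))

  *F-comm : ∀ a b → a *F b ≡ b *F a
  *F-comm = π-elim₂ _ λ m n → trans (π-* m n) (trans (cong π (ℕ.*-comm m n)) (sym (π-* n m)))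

  +F-identityˡ : ∀ a → 0F +F a ≡ a
  +F-identityˡ = π-elim₁ _ λ m → π-+ 0 m

  +F-identityʳ : ∀ a → a +F 0F ≡ a
  +F-identityʳ a = trans (+F-comm a 0F) (+F-identityˡ a)

  *F-identityˡ : ∀ a → 1F *F a ≡ a
  *F-identityˡ = π-elim₁ _ λ m → trans (π-* 1 m) (cong π (ℕ.*-identityˡ m))

  *F-identityʳ : ∀ a → a *F 1F ≡ a
  *F-identityʳ a = trans (*F-comm a 1F) (*F-identityˡ a)

  *F-distribˡ-+F : ∀ a b c → a *F (b +F c) ≡ (a *F b) +F (a *F c)
  *F-distribˡ-+F = π-elim₃ _ λ m n o → begin
    π m *F (π n +F π o)           ≡⟨ cong (π m *F_) (π-+ n o) ⟩
    π m *F π (n + o)              ≡⟨ π-* _ _ ⟩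
    π (m * (n + o))               ≡⟨ cong π (ℕ.*-distribˡ-+ m n o) ⟩
    π (m * n + m * o)             ≡⟨ sym (π-+ _ _) ⟩
    π (m * n) +F π (m * o)        ≡⟨ sym (cong₂ _+F_ (π-* m n) (π-* m o)) ⟩
    (π m *F π n) +F (π m *F π o)  ∎

  *F-distribʳ-+F : ∀ a b c → (b +F c) *F a ≡ (b *F a) +F (c *F a)
  *F-distribʳ-+F a b c =
    trans (*F-comm _ a) (trans (*F-distribˡ-+F a b c) (cong₂ _+F_ (*F-comm a b) (*F-comm a c)))

  π-p≡0F : π p ≡ 0F
  π-p≡0F = π-cong-% (trans (n%n≡0 p) (sym (m<n⇒m%n≡m (ℕ.>-nonZero⁻¹ p))))

  negF-inverseʳ : ∀ a → a +F (negF a) ≡ 0F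
  negF-inverseʳ a = begin
    a +F (negF a)                 ≡⟨ cong (_+F (negF a)) (sym (π-toℕ a)) ⟩
    π (toℕ a) +F π (p ∸ toℕ a)  ≡⟨ π-+ _ _ ⟩
    π (toℕ a + (p ∸ toℕ a))     ≡⟨ cong π (ℕ.m+[n∸m]≡n (ℕ.<⇒≤ (Fin.toℕ<n a))) ⟩
    π p                         ≡⟨ π-p≡0F ⟩
    0F                          ∎

  negF-inverseˡ : ∀ a → (negF a) +F a ≡ 0F
  negF-inverseˡ a = trans (+F-comm _ a) (negF-inverseʳ a)

  isCommutativeRing : IsCommutativeRing _≡_ _+F_ _*F_ negF 0F 1F
  isCommutativeRing = record
    { isRing = record
      { +-isAbelianGroup = record
        { isGroup = record
          { isMonoid = record
            { isSemigroup = record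
              { isMagma = record { isEquivalence = isEquivalence ; ∙-cong = cong₂ _+F_ }
              ; assoc = +F-assoc }
            ; identity = +F-identityˡ , +F-identityʳ }
          ; inverse = negF-inverseˡ , negF-inverseʳ
          ; ⁻¹-cong = cong negF }
        ; comm = +F-comm }
      ; *-cong = cong₂ _*F_
      ; *-assoc = *F-assoc
      ; *-identity = *F-identityˡ , *F-identityʳ
      ; distrib = *F-distribˡ-+F , *F-distribʳ-+F }
    ; *-comm = *F-comm }

  commutativeRing : CommutativeRing _ _
  commutativeRing = record { isCommutativeRing = isCommutativeRing }

  open import Algebra.Properties.CommutativeSemigroup (CommutativeRing.+-commutativeSemigroup commutativeRing)
    using () renaming (interchange to +F-interchange; xy∙z≈x∙zy to [x+y]+z≡x+[z+y]; x∙yz≈y∙xz to x+[y+z]≡y+[x+z])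
  open import Algebra.Properties.AbelianGroup (CommutativeRing.+-abelianGroup commutativeRing)
    using () renaming ( inverseʳ-unique to negF-unique; ε⁻¹≈ε to negF-0F; ⁻¹-∙-comm to negF-+F
                      ; xyx⁻¹≈y to x+y-x≡y; x∙y⁻¹≈ε⇒x≈y to x-y≡0⇒x≡y)

  *F-zeroʳ : ∀ a → a *F 0F ≡ 0F
  *F-zeroʳ = CommutativeRing.zeroʳ commutativeRing

  -F≡+F-negF : ∀ a b → a -F b ≡ a +F negF b
  -F≡+F-negF a b = trans (sym (π-+ (toℕ a) (p ∸ toℕ b))) (cong (_+F negF b) (π-toℕ a))

  toℕ-0F : toℕ 0F ≡ 0
  toℕ-0F = trans (toℕ-π 0) (m<n⇒m%n≡m (ℕ.>-nonZero⁻¹ p))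

  1<p : 1 < p
  1<p = ℕ.nonTrivial⇒n>1 p {{prime⇒nonTrivial pr}}

  1F≢0F : 1F ≢ 0F
  1F≢0F 1≡0 with trans (sym (m<n⇒m%n≡m 1<p)) (trans (sym (toℕ-π 1)) (trans (cong toℕ 1≡0) toℕ-0F))
  ... | ()

  NonZeroDivisor : Fp → Set
  NonZeroDivisor u = ∀ v → u *F v ≡ 0F → v ≡ 0F

  coprime⇒nonZeroDivisor : ∀ {q} → Coprime q p → NonZeroDivisor (π q)
  coprime⇒nonZeroDivisor {q} cop v qv≡0 = Fin.toℕ-injective (small-multiple⇒0 (Fin.toℕ<n v) p∣v)
    where
    %p≡0 : (q * toℕ v) % p ≡ 0
    %p≡0 = begin
      (q * toℕ v) % p    ≡⟨ sym (toℕ-π (q * toℕ v)) ⟩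
      toℕ (π (q * toℕ v)) ≡⟨ cong toℕ (sym (π-* q (toℕ v))) ⟩
      toℕ (π q *F π (toℕ v)) ≡⟨ cong (λ w → toℕ (π q *F w)) (π-toℕ v) ⟩
      toℕ (π q *F v) ≡⟨ cong toℕ qv≡0 ⟩
      toℕ 0F ≡⟨ toℕ-0F ⟩
      0 ∎
    p∣v : p ∣ toℕ v
    p∣v = coprime-divisor (Coprime.sym cop) (m%n≡0⇒n∣m _ p %p≡0)
    small-multiple⇒0 : ∀ {m} → m < p → p ∣ m → m ≡ toℕ 0F
    small-multiple⇒0 {zero}  _ _ = sym toℕ-0F
    small-multiple⇒0 {suc m} m<p p∣m = ⊥-elim (ℕ.<⇒≱ m<p (∣⇒≤ p∣m))

  ∑ : ∀ n → (Cube n → Fp) → Fp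
  ∑ = sumCube _+F_ 0F

  ∑-cong : ∀ n {f g : Cube n → Fp} → (∀ x → f x ≡ g x) → ∑ n f ≡ ∑ n g
  ∑-cong zero    f≗g = f≗g []
  ∑-cong (suc n) f≗g = cong₂ _+F_ (∑-cong n (f≗g ∘ (false ∷_))) (∑-cong n (f≗g ∘ (true ∷_)))

  ∑-0 : ∀ n → ∑ n (λ _ → 0F) ≡ 0F
  ∑-0 zero    = refl
  ∑-0 (suc n) = trans (cong₂ _+F_ (∑-0 n) (∑-0 n)) (+F-identityˡ 0F)

  ∑-+ : ∀ n (f g : Cube n → Fp) → ∑ n (λ x → f x +F g x) ≡ ∑ n f +F ∑ n g
  ∑-+ zero    f g = refl
  ∑-+ (suc n) f g = begin
    ∑ n (λ x → f₀ x +F g₀ x) +F ∑ n (λ x → f₁ x +F g₁ x)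
      ≡⟨ cong₂ _+F_ (∑-+ n f₀ g₀) (∑-+ n f₁ g₁) ⟩
    (∑ n f₀ +F ∑ n g₀) +F (∑ n f₁ +F ∑ n g₁)
      ≡⟨ +F-interchange (∑ n f₀) (∑ n g₀) (∑ n f₁) (∑ n g₁) ⟩
    (∑ n f₀ +F ∑ n f₁) +F (∑ n g₀ +F ∑ n g₁) ∎
    where f₀ = λ x → f (false ∷ x); f₁ = λ x → f (true ∷ x)
          g₀ = λ x → g (false ∷ x); g₁ = λ x → g (true ∷ x)

  infix 30 [_]·_

  [_]·_ : Bool → Fp → Fp
  [ b ]· a = if b then a else 0F

  []·-+F : ∀ b u v → [ b ]· (u +F v) ≡ [ b ]· u +F [ b ]· v
  []·-+F true  u v = refl
  []·-+F false u v = sym (+F-identityˡ 0F)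

  []·-0F : ∀ b → [ b ]· 0F ≡ 0F
  []·-0F true  = refl
  []·-0F false = refl

  evalML-cons : ∀ {n} b (x : Cube n) c →
    evalML c (b ∷ x) ≡ evalML (c ∘ (false ∷_)) x +F [ b ]· evalML (c ∘ (true ∷_)) x
  evalML-cons     true  x c = refl
  evalML-cons {n} false x c = cong (evalML (c ∘ (false ∷_)) x +F_) (∑-0 n)

  evalML-cong : ∀ {n} (x : Cube n) {c d : Cube n → Fp} → (∀ S → S ⊆ x → c S ≡ d S) →
    evalML c x ≡ evalML d x
  evalML-cong {n} x {c} {d} c≗d = ∑-cong n summand
    where
    summand : ∀ S → [ monomial S x ]· c S ≡ [ monomial S x ]· d S
    summand S with monomial S x in S⊆x
    ... | true  = c≗d S S⊆x
    ... | false = refl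

  evalML-+F : ∀ {n} (x : Cube n) c d → evalML (λ S → c S +F d S) x ≡ evalML c x +F evalML d x
  evalML-+F {n} x c d = trans (∑-cong n (λ S → []·-+F (monomial S x) (c S) (d S))) (∑-+ n _ _)

  evalML-0F : ∀ {n} (x : Cube n) → evalML (λ _ → 0F) x ≡ 0F
  evalML-0F {n} x = trans (∑-cong n (λ S → []·-0F (monomial S x))) (∑-0 n)

  evalML-negF : ∀ {n} (x : Cube n) c → evalML (λ S → negF (c S)) x ≡ negF (evalML c x)
  evalML-negF x c = negF-unique (evalML c x) _ (begin
    evalML c x +F evalML (λ S → negF (c S)) x ≡⟨ evalML-+F x c (λ S → negF (c S)) ⟨
    evalML (λ S → c S +F negF (c S)) x         ≡⟨ evalML-cong x (λ S _ → negF-inverseʳ (c S)) ⟩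
    evalML (λ _ → 0F) x                        ≡⟨ evalML-0F x ⟩
    0F                                         ∎)

  evalML-false : ∀ {n} (x : Cube n) c → evalML c (false ∷ x) ≡ evalML (c ∘ (false ∷_)) x
  evalML-false x c = trans (evalML-cons false x c) (+F-identityʳ _)

  evalML-∅ : ∀ {n} (c : Cube n → Fp) → evalML c ∅ ≡ c ∅
  evalML-∅ {zero}  c = refl
  evalML-∅ {suc n} c = trans (evalML-false ∅ c) (evalML-∅ (c ∘ (false ∷_)))

  evalML-restrict : ∀ {n} (x B : Cube n) g →
    evalML (λ U → [ monomial U (∁ B) ]· g U) x ≡ evalML g (x ─ B)
  evalML-restrict []      []          g = refl
  evalML-restrict (b ∷ x) (false ∷ B) g = begin
    evalML g′ (b ∷ x)
      ≡⟨ evalML-cons b x g′ ⟩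
    evalML (g′ ∘ (false ∷_)) x +F [ b ]· evalML (g′ ∘ (true ∷_)) x
      ≡⟨ cong₂ _+F_ (evalML-restrict x B _) (cong [ b ]·_ (evalML-restrict x B _)) ⟩
    evalML (g ∘ (false ∷_)) (x ─ B) +F [ b ]· evalML (g ∘ (true ∷_)) (x ─ B)
      ≡⟨ evalML-cons b (x ─ B) g ⟨
    evalML g (b ∷ (x ─ B)) ∎
    where g′ = λ U → [ monomial U (∁ (false ∷ B)) ]· g U
  evalML-restrict (b ∷ x) (true ∷ B)  g = begin
    evalML g′ (b ∷ x)
      ≡⟨ evalML-cons b x g′ ⟩
    evalML (g′ ∘ (false ∷_)) x +F [ b ]· evalML (λ _ → 0F) x
      ≡⟨ cong₂ _+F_ (evalML-restrict x B _) (trans (cong [ b ]·_ (evalML-0F x)) ([]·-0F b)) ⟩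
    evalML (g ∘ (false ∷_)) (x ─ B) +F 0F
      ≡⟨ evalML-cons false (x ─ B) g ⟨
    evalML g (false ∷ (x ─ B)) ∎
    where g′ = λ U → [ monomial U (∁ (true ∷ B)) ]· g U

  evalML-∪ : ∀ {n} (x B : Cube n) c →
    evalML c (x ∪ B) ≡ evalML (λ U → evalML (λ T → c (T ∪ U)) B) (x ─ B)
  evalML-∪ []      []          c = refl
  evalML-∪ (b ∷ x) (true ∷ B)  c = begin
    evalML c ((b ∨ true) ∷ (x ∪ B))
      ≡⟨ cong (λ b → evalML c (b ∷ (x ∪ B))) (Bool.∨-zeroʳ b) ⟩
    evalML (c ∘ (false ∷_)) (x ∪ B) +F evalML (c ∘ (true ∷_)) (x ∪ B)
      ≡⟨ cong₂ _+F_ (evalML-∪ x B _) (evalML-∪ x B _) ⟩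
    evalML P₀ (x ─ B) +F evalML P₁ (x ─ B)
      ≡⟨ evalML-+F (x ─ B) P₀ P₁ ⟨
    evalML (λ U → P₀ U +F P₁ U) (x ─ B)
      ≡⟨ evalML-false (x ─ B) G ⟨
    evalML G (false ∷ (x ─ B)) ∎
    where
    P₀ P₁ : Cube _ → Fp
    P₀ U = evalML (λ T → c (false ∷ (T ∪ U))) B
    P₁ U = evalML (λ T → c (true ∷ (T ∪ U))) B
    G = λ U → evalML (λ T → c (T ∪ U)) (true ∷ B)
  evalML-∪ (b ∷ x) (false ∷ B) c = begin
    evalML c ((b ∨ false) ∷ (x ∪ B))
      ≡⟨ cong (λ b → evalML c (b ∷ (x ∪ B))) (Bool.∨-identityʳ b) ⟩
    evalML c (b ∷ (x ∪ B))
      ≡⟨ evalML-cons b (x ∪ B) c ⟩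
    evalML (c ∘ (false ∷_)) (x ∪ B) +F [ b ]· evalML (c ∘ (true ∷_)) (x ∪ B)
      ≡⟨ cong₂ _+F_ (evalML-∪ x B _) (cong [ b ]·_ (evalML-∪ x B _)) ⟩
    evalML P₀ (x ─ B) +F [ b ]· evalML P₁ (x ─ B)
      ≡⟨ cong₂ _+F_ (evalML-cong (x ─ B) (λ U _ → sym (evalML-false B (λ T → c (T ∪ (false ∷ U))))))
                    (cong [ b ]·_ (evalML-cong (x ─ B) (λ U _ → sym (evalML-false B (λ T → c (T ∪ (true ∷ U))))))) ⟩
    evalML (G ∘ (false ∷_)) (x ─ B) +F [ b ]· evalML (G ∘ (true ∷_)) (x ─ B)
      ≡⟨ evalML-cons b (x ─ B) G ⟨
    evalML G (b ∷ (x ─ B)) ∎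
    where
    P₀ P₁ : Cube _ → Fp
    P₀ U = evalML (λ T → c (false ∷ (T ∪ U))) B
    P₁ U = evalML (λ T → c (true ∷ (T ∪ U))) B
    G = λ U → evalML (λ T → c (T ∪ U)) (false ∷ B)

  evalML-of-constant : ∀ {n} (B : Cube n) g → (∀ T → T ⊆ B → 1 ≤ weight T → g T ≡ 0F) →
    evalML g B ≡ g ∅
  evalML-of-constant []      g _    = refl
  evalML-of-constant (b ∷ B) g high = begin
    evalML g (b ∷ B)
      ≡⟨ evalML-cons b B g ⟩
    evalML (g ∘ (false ∷_)) B +F [ b ]· evalML (g ∘ (true ∷_)) B
      ≡⟨ cong₂ _+F_ (evalML-of-constant B _ (λ T → high (false ∷ T))) (top b high) ⟩
    g ∅ +F 0F
      ≡⟨ +F-identityʳ (g ∅) ⟩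
    g ∅ ∎
    where
    top : ∀ b → (∀ T → T ⊆ b ∷ B → 1 ≤ weight T → g T ≡ 0F) → [ b ]· evalML (g ∘ (true ∷_)) B ≡ 0F
    top false _    = refl
    top true  high = trans (evalML-cong B (λ T T⊆B → high (true ∷ T) T⊆B (s≤s z≤n))) (evalML-0F B)

  sumOver : ∀ {n} → Cube n → (Fin n → Fp) → Fp
  sumOver []      a = 0F
  sumOver (b ∷ B) a = [ b ]· a Fin.zero +F sumOver B (a ∘ Fin.suc)

  evalML-of-affine : ∀ {n} (B : Cube n) g → (∀ T → T ⊆ B → 2 ≤ weight T → g T ≡ 0F) →
    evalML g B ≡ g ∅ +F sumOver B (λ j → g ⁅ j ⁆)
  evalML-of-affine []      g _    = sym (+F-identityʳ _)
  evalML-of-affine (b ∷ B) g high = begin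
    evalML g (b ∷ B)
      ≡⟨ evalML-cons b B g ⟩
    evalML (g ∘ (false ∷_)) B +F [ b ]· evalML (g ∘ (true ∷_)) B
      ≡⟨ cong₂ _+F_ (evalML-of-affine B _ (λ T → high (false ∷ T))) (top b high) ⟩
    (g ∅ +F sumOver B (λ j → g ⁅ Fin.suc j ⁆)) +F [ b ]· g ⁅ Fin.zero ⁆
      ≡⟨ [x+y]+z≡x+[z+y] (g ∅) _ _ ⟩
    g ∅ +F sumOver (b ∷ B) (λ j → g ⁅ j ⁆) ∎
    where
    top : ∀ b → (∀ T → T ⊆ b ∷ B → 2 ≤ weight T → g T ≡ 0F) →
          [ b ]· evalML (g ∘ (true ∷_)) B ≡ [ b ]· g ⁅ Fin.zero ⁆
    top false _    = refl
    top true  high = evalML-of-constant B _ (λ T T⊆B 1≤∣T∣ → high (true ∷ T) T⊆B (s≤s 1≤∣T∣))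

  -- Lower bound

  sumOver-remove : ∀ {n} {B : Cube n} {j} (a : Fin n → Fp) → j ∈ B → sumOver B a ≡ a j +F sumOver (B - j) a
  sumOver-remove {B = true ∷ B} a here = cong (a Fin.zero +F_) (begin
    sumOver B (a ∘ Fin.suc)             ≡⟨ cong (λ C → sumOver C (a ∘ Fin.suc)) (p─⊥≡p B) ⟨
    sumOver (B ─ ∅) (a ∘ Fin.suc)       ≡⟨ +F-identityˡ _ ⟨
    0F +F sumOver (B ─ ∅) (a ∘ Fin.suc) ∎)
  sumOver-remove {B = b ∷ B} {Fin.suc j} a (there j∈B) = begin
    [ b ]· a Fin.zero +F sumOver B (a ∘ Fin.suc)
      ≡⟨ cong ([ b ]· a Fin.zero +F_) (sumOver-remove (a ∘ Fin.suc) j∈B) ⟩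
    [ b ]· a Fin.zero +F (a (Fin.suc j) +F sumOver (B - j) (a ∘ Fin.suc))
      ≡⟨ x+[y+z]≡y+[x+z] ([ b ]· a Fin.zero) _ _ ⟩
    a (Fin.suc j) +F sumOver ((b ∷ B) - Fin.suc j) a ∎

  sumOver-insert : ∀ {n} {B : Cube n} {j} (a : Fin n → Fp) → j ∉ B → sumOver (B ∪ ⁅ j ⁆) a ≡ a j +F sumOver B a
  sumOver-insert {B = true ∷ B} {Fin.zero} a j∉B = ⊥-elim (j∉B here)
  sumOver-insert {B = false ∷ B} {Fin.zero} a _ =
    cong (a Fin.zero +F_) (trans (cong (λ C → sumOver C (a ∘ Fin.suc)) (∪-identityʳ B)) (sym (+F-identityˡ _)))
  sumOver-insert {B = false ∷ B} {Fin.suc j} a j∉B = begin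
    0F +F sumOver (B ∪ ⁅ j ⁆) (a ∘ Fin.suc)           ≡⟨ +F-identityˡ _ ⟩
    sumOver (B ∪ ⁅ j ⁆) (a ∘ Fin.suc)                 ≡⟨ sumOver-insert (a ∘ Fin.suc) (j∉B ∘ there) ⟩
    a (Fin.suc j) +F sumOver B (a ∘ Fin.suc)          ≡⟨ cong (a (Fin.suc j) +F_) (+F-identityˡ _) ⟨
    a (Fin.suc j) +F sumOver (false ∷ B) a            ∎
  sumOver-insert {B = true ∷ B} {Fin.suc j} a j∉B = begin
    a Fin.zero +F sumOver (B ∪ ⁅ j ⁆) (a ∘ Fin.suc)
      ≡⟨ cong (a Fin.zero +F_) (sumOver-insert (a ∘ Fin.suc) (j∉B ∘ there)) ⟩
    a Fin.zero +F (a (Fin.suc j) +F sumOver B (a ∘ Fin.suc))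
      ≡⟨ x+[y+z]≡y+[x+z] (a Fin.zero) _ _ ⟩
    a (Fin.suc j) +F sumOver (true ∷ B) a ∎

  sumOver-const : ∀ {n} (B : Cube n) a v → (∀ {j} → j ∈ B → a j ≡ v) → sumOver B a ≡ π (weight B) *F v
  sumOver-const []          a v _     = sym (trans (*F-comm 0F v) (*F-zeroʳ v))
  sumOver-const (false ∷ B) a v a≡v   = trans (+F-identityˡ _) (sumOver-const B (a ∘ Fin.suc) v (a≡v ∘ there))
  sumOver-const (true ∷ B)  a v a≡v   = begin
    a Fin.zero +F sumOver B (a ∘ Fin.suc)
      ≡⟨ cong₂ _+F_ (trans (a≡v here) (sym (*F-identityˡ v))) (sumOver-const B (a ∘ Fin.suc) v (a≡v ∘ there)) ⟩
    (π 1 *F v) +F (π (weight B) *F v)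
      ≡⟨ *F-distribʳ-+F v (π 1) (π (weight B)) ⟨
    (π 1 +F π (weight B)) *F v
      ≡⟨ cong (_*F v) (π-+ 1 (weight B)) ⟩
    π (suc (weight B)) *F v ∎

  swap-sumOver≢0 : ∀ {n} {Q : Cube n} {j s} (a : Fin n → Fp) → sumOver Q a ≡ 0F → j ∈ Q → s ∉ Q → a j ≢ a s →
    sumOver ((Q - j) ∪ ⁅ s ⁆) a ≢ 0F
  swap-sumOver≢0 {Q = Q} {j} {s} a ΣQ≡0 j∈Q s∉Q aj≢as Σ≡0 = aj≢as (sym (x-y≡0⇒x≡y (a s) (a j) (begin
    a s +F negF (a j)          ≡⟨ cong (a s +F_) Σ[Q-j]≡-aj ⟨
    a s +F sumOver (Q - j) a   ≡⟨ sumOver-insert a (s∉Q ∘ ∈-⊆ {X = Q - j} (p-x⊆p Q j)) ⟨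
    sumOver ((Q - j) ∪ ⁅ s ⁆) a ≡⟨ Σ≡0 ⟩
    0F                         ∎)))
    where
    Σ[Q-j]≡-aj : sumOver (Q - j) a ≡ negF (a j)
    Σ[Q-j]≡-aj = negF-unique (a j) _ (trans (sym (sumOver-remove a j∈Q)) ΣQ≡0)

  SupportedIn : ∀ {n} → Cube n → (Cube n → Fp) → Set
  SupportedIn A c = ∀ S → monomial S A ≡ false → c S ≡ 0F

  supportedIn-full : ∀ {n} (c : Cube n → Fp) → SupportedIn full c
  supportedIn-full c S S⊈full with trans (sym (⊆full S)) S⊈full
  ... | ()

  supportedIn-⊆ : ∀ {n} (A : Cube n) c S → SupportedIn A c → c S ≢ 0F → S ⊆ A
  supportedIn-⊆ A c S supp cS≢0 with monomial S A in S⊆A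
  ... | true  = refl
  ... | false = ⊥-elim (cS≢0 (supp S S⊆A))

  DegreeAtMost : ∀ {n} → ℕ → (Cube n → Fp) → Set
  DegreeAtMost d c = ∀ S → d < weight S → c S ≡ 0F

  -- Coefficients of x ↦ f (x ∪ B) − f x, as a function on the points disjoint from B.
  Δ : ∀ {n} → Cube n → (Cube n → Fp) → Cube n → Fp
  Δ B c U = [ monomial U (∁ B) ]· (evalML (λ T → c (T ∪ U)) B +F negF (c U))

  evalML-Δ : ∀ {n} (B x : Cube n) c → x ⊆ ∁ B → evalML (Δ B c) x ≡ evalML c (x ∪ B) +F negF (evalML c x)
  evalML-Δ B x c x⊆∁B = begin
    evalML (Δ B c) x
      ≡⟨ evalML-restrict x B _ ⟩
    evalML (λ U → evalML (λ T → c (T ∪ U)) B +F negF (c U)) (x ─ B)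
      ≡⟨ evalML-+F (x ─ B) _ _ ⟩
    evalML (λ U → evalML (λ T → c (T ∪ U)) B) (x ─ B) +F evalML (negF ∘ c) (x ─ B)
      ≡⟨ cong₂ _+F_ (sym (evalML-∪ x B c)) (evalML-negF (x ─ B) c) ⟩
    evalML c (x ∪ B) +F negF (evalML c (x ─ B))
      ≡⟨ cong (λ y → evalML c (x ∪ B) +F negF (evalML c y)) (─-disjoint x B x⊆∁B) ⟩
    evalML c (x ∪ B) +F negF (evalML c x) ∎

  Δ-supportedIn : ∀ {n} (A B : Cube n) c → SupportedIn A c → SupportedIn (A ─ B) (Δ B c)
  Δ-supportedIn A B c supp U U⊈A─B with monomial U (∁ B) in U⊆∁B
  ... | false = refl
  ... | true  = begin
    evalML (λ T → c (T ∪ U)) B +F negF (c U)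
      ≡⟨ cong₂ (λ u v → u +F negF v) (trans (evalML-cong B (λ T _ → supp (T ∪ U) (T∪U⊈A T))) (evalML-0F B))
                                     (supp U U⊈A) ⟩
    0F +F negF 0F
      ≡⟨ negF-inverseʳ 0F ⟩
    0F ∎
    where
    U⊈A : monomial U A ≡ false
    U⊈A with monomial U A in U⊆A
    ... | false = refl
    ... | true  = trans (sym (trans (monomial-─ U A B) (cong₂ _∧_ U⊆A U⊆∁B))) U⊈A─B
    T∪U⊈A : ∀ T → monomial (T ∪ U) A ≡ false
    T∪U⊈A T = trans (monomial-∪ T U A) (trans (cong (monomial T A ∧_) U⊈A) (Bool.∧-zeroʳ _))

  Δ-degreeAtMost : ∀ {n d} (B : Cube n) c → DegreeAtMost (suc d) c → DegreeAtMost d (Δ B c)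
  Δ-degreeAtMost {d = d} B c deg U d<∣U∣ with monomial U (∁ B) in U⊆∁B
  ... | false = refl
  ... | true  = begin
    evalML (λ T → c (T ∪ U)) B +F negF (c U)
      ≡⟨ cong (_+F negF (c U)) (evalML-of-constant B _ higher-terms) ⟩
    c (∅ ∪ U) +F negF (c U)
      ≡⟨ cong (λ V → c V +F negF (c U)) (∪-identityˡ U) ⟩
    c U +F negF (c U)
      ≡⟨ negF-inverseʳ (c U) ⟩
    0F ∎
    where
    higher-terms : ∀ T → T ⊆ B → 1 ≤ weight T → c (T ∪ U) ≡ 0F
    higher-terms T T⊆B 1≤∣T∣ =
      deg (T ∪ U) (subst (suc d <_) (sym (weight-∪ T U B T⊆B U⊆∁B)) (ℕ.+-mono-≤ 1≤∣T∣ d<∣U∣))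

  Δ-at : ∀ {n d} (B S : Cube n) c → DegreeAtMost (suc d) c → weight S ≡ d → S ⊆ ∁ B →
    Δ B c S ≡ sumOver B (λ j → c (⁅ j ⁆ ∪ S))
  Δ-at {d = d} B S c deg ∣S∣≡d S⊆∁B rewrite S⊆∁B = begin
    evalML (λ T → c (T ∪ S)) B +F negF (c S)  ≡⟨ cong (_+F negF (c S)) (evalML-of-affine B _ higher-terms) ⟩
    (c (∅ ∪ S) +F σ) +F negF (c S)           ≡⟨ cong (λ V → (c V +F σ) +F negF (c S)) (∪-identityˡ S) ⟩
    (c S +F σ) +F negF (c S)                 ≡⟨ x+y-x≡y (c S) σ ⟩
    σ                                        ∎
    where
    σ = sumOver B (λ j → c (⁅ j ⁆ ∪ S))
    higher-terms : ∀ T → T ⊆ B → 2 ≤ weight T → c (T ∪ S) ≡ 0F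
    higher-terms T T⊆B 2≤∣T∣ =
      deg (T ∪ S) (subst (suc d <_) (sym ∣T∪S∣) (ℕ.+-monoˡ-≤ d 2≤∣T∣))
      where ∣T∪S∣ = trans (weight-∪ T S B T⊆B S⊆∁B) (cong (weight T +_) ∣S∣≡d)

  module _ {q} {{_ : NonZero q}} (q-nzd : NonZeroDivisor (π q)) where

    q-subset-with-nonzero-sum : ∀ {n} (P : Cube n) (a : Fin n → Fp) {s} → s ∈ P → a s ≢ 0F → suc q ≤ weight P →
      Σ (Cube n) λ B → B ⊆ P × weight B ≡ q × sumOver B a ≢ 0F
    q-subset-with-nonzero-sum {n} P a {s} s∈P as≢0 q<∣P∣
      with subset-of-size q (P - s) (ℕ.≤-pred (subst (suc q ≤_) (sym (weight-remove s∈P)) q<∣P∣))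
    ... | Q , Q⊆P-s , ∣Q∣≡q = adjust (⊆-trans Q (P - s) P Q⊆P-s (p-x⊆p P s)) (x∉p-x ∘ ∈-⊆ {X = Q} Q⊆P-s)
      where
      adjust : Q ⊆ P → s ∉ Q → Σ (Cube n) λ B → B ⊆ P × weight B ≡ q × sumOver B a ≢ 0F
      adjust Q⊆P s∉Q with sumOver Q a ≟ 0F | Fin.any? (λ j → (j ∈? Q) ×-dec ¬? (a j ≟ a s))
      ... | no ΣQ≢0  | _                     = Q , Q⊆P , ∣Q∣≡q , ΣQ≢0
      ... | yes ΣQ≡0 | yes (j , j∈Q , aj≢as) =
        (Q - j) ∪ ⁅ s ⁆ ,
        insert-⊆ {B = Q - j} (⊆-trans (Q - j) Q P (p-x⊆p Q j) Q⊆P) s∈P ,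
        trans (weight-insert (s∉Q ∘ ∈-⊆ {X = Q - j} (p-x⊆p Q j))) (trans (weight-remove j∈Q) ∣Q∣≡q) ,
        swap-sumOver≢0 a ΣQ≡0 j∈Q s∉Q aj≢as
      ... | yes ΣQ≡0 | no ∄j                 = ⊥-elim (as≢0 (q-nzd (a s) (begin
        π q *F a s          ≡⟨ cong (λ k → π k *F a s) ∣Q∣≡q ⟨
        π (weight Q) *F a s ≡⟨ sumOver-const Q a (a s) aj≡as ⟨
        sumOver Q a         ≡⟨ ΣQ≡0 ⟩
        0F                  ∎)))
        where
        aj≡as : ∀ {j} → j ∈ Q → a j ≡ a s
        aj≡as {j} j∈Q with a j ≟ a s
        ... | yes aj≡as = aj≡as
        ... | no aj≢as  = ⊥-elim (∄j (j , j∈Q , aj≢as))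

    VanishesOnMultiples : ∀ {n} → Cube n → (Cube n → Fp) → Set
    VanishesOnMultiples A c = ∀ x → x ⊆ A → q ∣ weight x → evalML c x ≡ 0F

    Δ-vanishesOnMultiples : ∀ {n} (A B : Cube n) c → B ⊆ A → weight B ≡ q → VanishesOnMultiples A c →
      VanishesOnMultiples (A ─ B) (Δ B c)
    Δ-vanishesOnMultiples A B c B⊆A ∣B∣≡q van x x⊆A─B q∣∣x∣ = begin
      evalML (Δ B c) x
        ≡⟨ evalML-Δ B x c x⊆∁B ⟩
      evalML c (x ∪ B) +F negF (evalML c x)
        ≡⟨ cong₂ (λ u v → u +F negF v) (van (x ∪ B) x∪B⊆A q∣∣x∪B∣) (van x x⊆A q∣∣x∣) ⟩
      0F +F negF 0F
        ≡⟨ negF-inverseʳ 0F ⟩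
      0F ∎
      where
      x⊆A = proj₁ (⊆-─⁻ x A B x⊆A─B)
      x⊆∁B = proj₂ (⊆-─⁻ x A B x⊆A─B)
      x∪B⊆A = ⊆-∪⁺ x B A x⊆A B⊆A
      ∣x∪B∣≡q+∣x∣ : weight (x ∪ B) ≡ q + weight x
      ∣x∪B∣≡q+∣x∣ = trans (cong weight (∪-comm x B)) (trans (weight-∪ B x B (⊆-refl B) x⊆∁B) (cong (_+ weight x) ∣B∣≡q))
      q∣∣x∪B∣ : q ∣ weight (x ∪ B)
      q∣∣x∪B∣ = subst (q ∣_) (sym ∣x∪B∣≡q+∣x∣) (∣m∣n⇒∣m+n ∣-refl q∣∣x∣)

    CoefficientsVanish : ℕ → Set
    CoefficientsVanish d = ∀ {n} (A : Cube n) c → SupportedIn A c → DegreeAtMost d c → VanishesOnMultiples A c →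
      d * q < weight A → ∀ S → c S ≡ 0F

    nonzero-Δ-coefficient : ∀ {d n} (A : Cube n) c S → DegreeAtMost (suc d) c → S ⊆ A → weight S ≡ suc d → c S ≢ 0F →
      suc d * q < weight A → Σ (Cube n) λ B → B ⊆ A × weight B ≡ q × Σ (Cube n) λ S′ → Δ B c S′ ≢ 0F
    nonzero-Δ-coefficient {d} {n} A c S deg S⊆A ∣S∣ cS≢0 big =
      remove-point (nonempty S (subst (1 ≤_) (sym ∣S∣) (s≤s z≤n)))
      where
      remove-point : ∃ (_∈ S) → Σ (Cube n) λ B → B ⊆ A × weight B ≡ q × Σ (Cube n) λ S′ → Δ B c S′ ≢ 0F
      remove-point (s , s∈S) = choose-B (q-subset-with-nonzero-sum (A ─ S′) a s∈A─S′ as≢0 q<∣A─S′∣)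
        where
        S′ = S - s
        a : Fin n → Fp
        a j = c (⁅ j ⁆ ∪ S′)
        as≢0 : a s ≢ 0F
        as≢0 = cS≢0 ∘ trans (cong c (sym (⁅s⁆∪[S-s] s∈S)))
        S′⊆A : S′ ⊆ A
        S′⊆A = ⊆-trans S′ S A (p-x⊆p S s) S⊆A
        ∣S′∣≡d : weight S′ ≡ d
        ∣S′∣≡d = ℕ.suc-injective (trans (weight-remove s∈S) ∣S∣)
        s∈A─S′ : s ∈ A ─ S′
        s∈A─S′ = x∈p∧x∉q⇒x∈p─q (∈-⊆ {X = S} S⊆A s∈S) x∉p-x
        q<∣A─S′∣ : suc q ≤ weight (A ─ S′)
        q<∣A─S′∣ = [1+d]q<m+d⇒1+q≤m d q (trans (cong (weight (A ─ S′) +_) (sym ∣S′∣≡d)) (weight-─ A S′ S′⊆A)) big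
        choose-B : Σ (Cube n) (λ B → B ⊆ A ─ S′ × weight B ≡ q × sumOver B a ≢ 0F) →
                   Σ (Cube n) λ B → B ⊆ A × weight B ≡ q × Σ (Cube n) λ S′ → Δ B c S′ ≢ 0F
        choose-B (B , B⊆A─S′ , ∣B∣≡q , σ≢0) =
          B , proj₁ (⊆-─⁻ B A S′ B⊆A─S′) , ∣B∣≡q , S′ ,
          σ≢0 ∘ trans (sym (Δ-at B S′ c deg ∣S′∣≡d (disjoint-sym B S′ (proj₂ (⊆-─⁻ B A S′ B⊆A─S′)))))

    top-coefficients-vanish : ∀ {d} → CoefficientsVanish d → ∀ {n} (A : Cube n) c → SupportedIn A c →
      DegreeAtMost (suc d) c → VanishesOnMultiples A c → suc d * q < weight A → ∀ S → weight S ≡ suc d → c S ≡ 0F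
    top-coefficients-vanish {d} IH A c supp deg van big S ∣S∣ = by-contradiction (c S ≟ 0F)
      where
      Δ-vanishes : ∀ {B} → B ⊆ A → weight B ≡ q → ∀ S′ → Δ B c S′ ≡ 0F
      Δ-vanishes {B} B⊆A ∣B∣≡q = IH (A ─ B) (Δ B c)
        (Δ-supportedIn A B c supp) (Δ-degreeAtMost B c deg) (Δ-vanishesOnMultiples A B c B⊆A ∣B∣≡q van)
        ([1+d]q<m+q⇒dq<m d q (trans (cong (weight (A ─ B) +_) (sym ∣B∣≡q)) (weight-─ A B B⊆A)) big)
      by-contradiction : Dec (c S ≡ 0F) → c S ≡ 0F
      by-contradiction (yes cS≡0) = cS≡0
      by-contradiction (no  cS≢0) =
        ⊥-elim (refute (nonzero-Δ-coefficient A c S deg (supportedIn-⊆ A c S supp cS≢0) ∣S∣ cS≢0 big))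
        where
        refute : ¬ (Σ (Cube _) λ B → B ⊆ A × weight B ≡ q × Σ (Cube _) λ S′ → Δ B c S′ ≢ 0F)
        refute (B , B⊆A , ∣B∣≡q , S′ , ΔS′≢0) = ΔS′≢0 (Δ-vanishes B⊆A ∣B∣≡q S′)

    coefficients-vanish : ∀ d → CoefficientsVanish d
    coefficients-vanish zero {n} A c supp deg van _ S with weight S in ∣S∣
    ... | zero  = begin
      c S        ≡⟨ cong c (weight≡0⇒∅ S ∣S∣) ⟩
      c ∅        ≡⟨ evalML-∅ c ⟨
      evalML c ∅ ≡⟨ van ∅ (∅⊆ A) (subst (q ∣_) (sym (weight-∅ n)) (q ∣0)) ⟩
      0F         ∎
    ... | suc _ = deg S (subst (0 <_) (sym ∣S∣) (s≤s z≤n))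
    coefficients-vanish (suc d) A c supp deg van big =
      coefficients-vanish d A c supp deg′ van (ℕ.<-≤-trans (s≤s (ℕ.m≤n+m (d * q) q)) big)
      where
      deg′ : DegreeAtMost d c
      deg′ S d<∣S∣ with ℕ.m≤n⇒m<n∨m≡n d<∣S∣
      ... | inj₁ d+1<∣S∣ = deg S d+1<∣S∣
      ... | inj₂ d+1≡∣S∣ = top-coefficients-vanish (coefficients-vanish d) A c supp deg van big S (sym d+1≡∣S∣)

  -- Upper bound

  -- binomialSum D w = ∑ⱼ (w choose j) · D j, computed by Pascal's rule.
  binomialSum : (ℕ → Fp) → ℕ → Fp
  binomialSum D zero    = D 0
  binomialSum D (suc w) = binomialSum D w +F binomialSum (D ∘ suc) w

  evalML-symmetric : ∀ {m} (D : ℕ → Fp) (y : Cube m) → evalML (λ S → D (weight S)) y ≡ binomialSum D (weight y)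
  evalML-symmetric D []          = refl
  evalML-symmetric D (false ∷ y) = trans (evalML-false y (λ S → D (weight S))) (evalML-symmetric D y)
  evalML-symmetric D (true ∷ y)  = cong₂ _+F_ (evalML-symmetric D y) (evalML-symmetric (D ∘ suc) y)

  binomialSum-− : ∀ (D E : ℕ → Fp) w →
    binomialSum (λ j → D j +F negF (E j)) w ≡ binomialSum D w +F negF (binomialSum E w)
  binomialSum-− D E zero    = refl
  binomialSum-− D E (suc w) = begin
    binomialSum (λ j → D j +F negF (E j)) w +F binomialSum (λ j → D (suc j) +F negF (E (suc j))) w
      ≡⟨ cong₂ _+F_ (binomialSum-− D E w) (binomialSum-− (D ∘ suc) (E ∘ suc) w) ⟩
    (binomialSum D w +F negF (binomialSum E w)) +F (binomialSum (D ∘ suc) w +F negF (binomialSum (E ∘ suc) w))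
      ≡⟨ +F-interchange (binomialSum D w) _ _ _ ⟩
    (binomialSum D w +F binomialSum (D ∘ suc) w) +F (negF (binomialSum E w) +F negF (binomialSum (E ∘ suc) w))
      ≡⟨ cong (binomialSum D (suc w) +F_) (negF-+F (binomialSum E w) _) ⟩
    binomialSum D (suc w) +F negF (binomialSum E (suc w))
      ∎

  binomialSum-triangular : ∀ (D : ℕ → Fp) j → (∀ i → i < j → D i ≡ 0F) → binomialSum D j ≡ D j
  binomialSum-triangular D zero    _      = refl
  binomialSum-triangular D (suc j) D<j≡0 = begin
    binomialSum D j +F binomialSum (D ∘ suc) j
      ≡⟨ cong₂ _+F_ Dⱼ≡0 (binomialSum-triangular (D ∘ suc) j (λ i i<j → D<j≡0 (suc i) (s≤s i<j))) ⟩
    0F +F D (suc j)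
      ≡⟨ +F-identityˡ _ ⟩
    D (suc j) ∎
    where
    Dⱼ≡0 : binomialSum D j ≡ 0F
    Dⱼ≡0 = trans (binomialSum-triangular D j (λ i i<j → D<j≡0 i (ℕ.m<n⇒m<1+n i<j))) (D<j≡0 j ℕ.≤-refl)

  binomialSum-vanishing : ∀ (D : ℕ → Fp) j → (∀ w → w ≤ j → binomialSum D w ≡ 0F) → ∀ i → i ≤ j → D i ≡ 0F
  binomialSum-vanishing D zero    B≡0 zero _ = B≡0 0 z≤n
  binomialSum-vanishing D (suc j) B≡0 = D≡0
    where
    below : ∀ i → i ≤ j → D i ≡ 0F
    below = binomialSum-vanishing D j (λ w w≤j → B≡0 w (ℕ.m≤n⇒m≤1+n w≤j))
    D≡0 : ∀ i → i ≤ suc j → D i ≡ 0F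
    D≡0 i i≤j+1 with ℕ.m≤n⇒m<n∨m≡n i≤j+1
    ... | inj₁ i<j+1 = below i (ℕ.≤-pred i<j+1)
    ... | inj₂ refl  = trans (sym (binomialSum-triangular D (suc j) (λ k k<j+1 → below k (ℕ.≤-pred k<j+1))))
                             (B≡0 (suc j) ℕ.≤-refl)

  extendByZero : ∀ {k} → (Fin k → Fp) → ℕ → Fp
  extendByZero {zero}  v _       = 0F
  extendByZero {suc k} v zero    = v Fin.zero
  extendByZero {suc k} v (suc j) = extendByZero (v ∘ Fin.suc) j

  extendByZero-toℕ : ∀ {k} (v : Fin k → Fp) i → extendByZero v (toℕ i) ≡ v i
  extendByZero-toℕ v Fin.zero    = refl
  extendByZero-toℕ v (Fin.suc i) = extendByZero-toℕ (v ∘ Fin.suc) i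

  extendByZero-≥ : ∀ {k} (v : Fin k → Fp) j → k ≤ j → extendByZero v j ≡ 0F
  extendByZero-≥ {zero}  v j       _         = refl
  extendByZero-≥ {suc k} v (suc j) (s≤s k≤j) = extendByZero-≥ (v ∘ Fin.suc) j k≤j

  record BinomialKernelVector (K : ℕ) (W : Fin K → ℕ) : Set where
    field
      D        : ℕ → Fp
      D-high   : ∀ j → K < j → D j ≡ 0F
      j₀       : ℕ
      j₀≤K     : j₀ ≤ K
      D[j₀]≢0  : D j₀ ≢ 0F
      D-kernel : ∀ r → binomialSum D (W r) ≡ 0F

  -- Two of the p^(K+1) vectors v have the same K values binomialSum v (W r); their difference works.
  binomialSum-kernel : ∀ K (W : Fin K → ℕ) → BinomialKernelVector K W
  binomialSum-kernel K W with function-pigeonhole 1<p (λ v r → binomialSum (extendByZero v) (W r))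
  ... | v , w , (i , vᵢ≢wᵢ) , same = record
    { D = D ; D-high = D-high ; j₀ = toℕ i ; j₀≤K = ℕ.≤-pred (Fin.toℕ<n i) ; D[j₀]≢0 = Dᵢ≢0 ; D-kernel = D-kernel }
    where
    D : ℕ → Fp
    D j = extendByZero v j +F negF (extendByZero w j)
    D-high : ∀ j → K < j → D j ≡ 0F
    D-high j K<j = begin
      extendByZero v j +F negF (extendByZero w j)
        ≡⟨ cong₂ (λ a b → a +F negF b) (extendByZero-≥ v j K<j) (extendByZero-≥ w j K<j) ⟩
      0F +F negF 0F
        ≡⟨ negF-inverseʳ 0F ⟩
      0F ∎
    Dᵢ≢0 : D (toℕ i) ≢ 0F
    Dᵢ≢0 Dᵢ≡0 = vᵢ≢wᵢ (begin
      v i                      ≡⟨ extendByZero-toℕ v i ⟨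
      extendByZero v (toℕ i)   ≡⟨ x-y≡0⇒x≡y _ _ Dᵢ≡0 ⟩
      extendByZero w (toℕ i)   ≡⟨ extendByZero-toℕ w i ⟩
      w i                      ∎)
    D-kernel : ∀ r → binomialSum D (W r) ≡ 0F
    D-kernel r = begin
      binomialSum D (W r)
        ≡⟨ binomialSum-− (extendByZero v) (extendByZero w) (W r) ⟩
      binomialSum (extendByZero v) (W r) +F negF (binomialSum (extendByZero w) (W r))
        ≡⟨ cong (λ a → a +F negF (binomialSum (extendByZero w) (W r))) (same r) ⟩
      binomialSum (extendByZero w) (W r) +F negF (binomialSum (extendByZero w) (W r))
        ≡⟨ negF-inverseʳ _ ⟩
      0F ∎

  -- Coefficients of (x₁ − x₂) · ∑ⱼ D j · eⱼ(y), with eⱼ the elementary symmetric polynomials in y.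
  x₁-x₂-times-symmetric : ∀ {m} → (ℕ → Fp) → Cube (suc (suc m)) → Fp
  x₁-x₂-times-symmetric D (true  ∷ false ∷ S) = D (weight S)
  x₁-x₂-times-symmetric D (false ∷ true  ∷ S) = negF (D (weight S))
  x₁-x₂-times-symmetric D (false ∷ false ∷ S) = 0F
  x₁-x₂-times-symmetric D (true  ∷ true  ∷ S) = 0F

  evalML-x₁-x₂-times-symmetric : ∀ {m} D x₁ x₂ (y : Cube m) →
    evalML (x₁-x₂-times-symmetric D) (x₁ ∷ x₂ ∷ y)
      ≡ [ x₁ ]· binomialSum D (weight y) +F [ x₂ ]· negF (binomialSum D (weight y))
  evalML-x₁-x₂-times-symmetric D x₁ x₂ y = begin
    evalML c (x₁ ∷ x₂ ∷ y)
      ≡⟨ evalML-cons x₁ (x₂ ∷ y) c ⟩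
    evalML (c ∘ (false ∷_)) (x₂ ∷ y) +F [ x₁ ]· evalML (c ∘ (true ∷_)) (x₂ ∷ y)
      ≡⟨ cong₂ _+F_ x₁-free (cong [ x₁ ]·_ x₁-part) ⟩
    (0F +F [ x₂ ]· negF G) +F [ x₁ ]· G
      ≡⟨ cong (_+F [ x₁ ]· G) (+F-identityˡ _) ⟩
    [ x₂ ]· negF G +F [ x₁ ]· G
      ≡⟨ +F-comm ([ x₂ ]· negF G) _ ⟩
    [ x₁ ]· G +F [ x₂ ]· negF G ∎
    where
    c = x₁-x₂-times-symmetric D
    G = binomialSum D (weight y)
    x₁-free : evalML (c ∘ (false ∷_)) (x₂ ∷ y) ≡ 0F +F [ x₂ ]· negF G
    x₁-free = trans (evalML-cons x₂ y (c ∘ (false ∷_)))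
      (cong₂ _+F_ (evalML-0F y)
                  (cong [ x₂ ]·_ (trans (evalML-negF y (λ S → D (weight S))) (cong negF (evalML-symmetric D y)))))
    x₁-part : evalML (c ∘ (true ∷_)) (x₂ ∷ y) ≡ G
    x₁-part = begin
      evalML (c ∘ (true ∷_)) (x₂ ∷ y)
        ≡⟨ evalML-cons x₂ y (c ∘ (true ∷_)) ⟩
      evalML (λ S → D (weight S)) y +F [ x₂ ]· evalML (λ _ → 0F) y
        ≡⟨ cong₂ _+F_ (evalML-symmetric D y) (trans (cong [ x₂ ]·_ (evalML-0F y)) ([]·-0F x₂)) ⟩
      G +F 0F
        ≡⟨ +F-identityʳ G ⟩
      G ∎

  x₁-x₂-times-symmetric-degree : ∀ {m} K (D : ℕ → Fp) → (∀ j → K < j → D j ≡ 0F) →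
    ∀ S → suc K < weight S → x₁-x₂-times-symmetric {m} D S ≡ 0F
  x₁-x₂-times-symmetric-degree K D D-high (true  ∷ false ∷ S) (s≤s K<∣S∣) = D-high (weight S) K<∣S∣
  x₁-x₂-times-symmetric-degree K D D-high (false ∷ true  ∷ S) (s≤s K<∣S∣) =
    trans (cong negF (D-high (weight S) K<∣S∣)) negF-0F
  x₁-x₂-times-symmetric-degree K D D-high (true  ∷ true  ∷ S) _           = refl
  x₁-x₂-times-symmetric-degree K D D-high (false ∷ false ∷ S) _           = refl

  x₁-x₂-times-symmetric-nonzero : ∀ {m} (D : ℕ → Fp) j → j ≤ m → D j ≢ 0F → Nonzero (evalML (x₁-x₂-times-symmetric {m} D))
  x₁-x₂-times-symmetric-nonzero {m} D j j≤m Dj≢0 f≡0 = Dj≢0 (binomialSum-vanishing D m G≡0 j j≤m)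
    where
    G≡0 : ∀ w → w ≤ m → binomialSum D w ≡ 0F
    G≡0 w w≤m = let y , _ , ∣y∣≡w = subset-of-size w full (subst (w ≤_) (sym (weight-full m)) w≤m) in begin
      binomialSum D w
        ≡⟨ cong (binomialSum D) ∣y∣≡w ⟨
      binomialSum D (weight y)
        ≡⟨ +F-identityʳ _ ⟨
      binomialSum D (weight y) +F [ false ]· negF (binomialSum D (weight y))
        ≡⟨ evalML-x₁-x₂-times-symmetric D true false y ⟨
      evalML (x₁-x₂-times-symmetric D) (true ∷ false ∷ y)
        ≡⟨ f≡0 (true ∷ false ∷ y) ⟩
      0F ∎

  -- Immunity of ¬χ_q

  module _ (q : ℕ) (hq : 2 ≤ q) (cop : Coprime q p) where

    instance
      nonZero-q : NonZero q
      nonZero-q = 2≤⇒nonZero hq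

    notChi-multiple : ∀ {n} (x : Cube n) → q ∣ weight x → notChi q x ≡ 0F
    notChi-multiple x q∣∣x∣ with q ∣? weight x
    ... | yes _        = trans (-F≡+F-negF 1F 1F) (negF-inverseʳ 1F)
    ... | no  q∤∣x∣    = ⊥-elim (q∤∣x∣ q∣∣x∣)

    notChi-nonmultiple : ∀ {n} (x : Cube n) → ¬ q ∣ weight x → notChi q x ≡ 1F
    notChi-nonmultiple x q∤∣x∣ with q ∣? weight x
    ... | yes q∣∣x∣ = ⊥-elim (q∤∣x∣ q∣∣x∣)
    ... | no  _     = trans (-F≡+F-negF 1F 0F) (trans (cong (1F +F_) negF-0F) (+F-identityʳ 1F))

    inIdeal⇒vanishes : ∀ {n} (f : R n) → InIdeal (notChi q) f → ∀ x → q ∣ weight x → f x ≡ 0F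
    inIdeal⇒vanishes f (h , f≡h¬χ) x q∣∣x∣ =
      trans (f≡h¬χ x) (trans (cong (h x *F_) (notChi-multiple x q∣∣x∣)) (*F-zeroʳ (h x)))

    vanishes⇒inIdeal : ∀ {n} (f : R n) → (∀ x → q ∣ weight x → f x ≡ 0F) → InIdeal (notChi q) f
    vanishes⇒inIdeal f vanishes = f , f≡f¬χ
      where
      f≡f¬χ : ∀ x → f x ≡ f x *F notChi q x
      f≡f¬χ x = by-cases (q ∣? weight x)
        where
        by-cases : Dec (q ∣ weight x) → f x ≡ f x *F notChi q x
        by-cases (yes q∣∣x∣) =
          trans (vanishes x q∣∣x∣) (sym (trans (cong (f x *F_) (notChi-multiple x q∣∣x∣)) (*F-zeroʳ (f x))))
        by-cases (no  q∤∣x∣) = sym (trans (cong (f x *F_) (notChi-nonmultiple x q∤∣x∣)) (*F-identityʳ (f x)))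

    immunity-lower-bound : ∀ n (f : R n) → InIdeal (notChi q) f → Nonzero f →
      ∀ d → DegLE f d → floorDiv (n + q ∸ 1) q hq ≤ d
    immunity-lower-bound n f f∈⟨¬χ⟩ f≢0 d (c , deg , evalML-c≡f) with d * q <? n
    ... | no  dq≮n = ⌈/⌉-≤ n d q (ℕ.≮⇒≥ dq≮n)
    ... | yes dq<n = ⊥-elim (f≢0 λ x →
      trans (sym (evalML-c≡f x)) (trans (evalML-cong x (λ S _ → c≡0 S)) (evalML-0F x)))
      where
      c≡0 : ∀ S → c S ≡ 0F
      c≡0 = coefficients-vanish (coprime⇒nonZeroDivisor cop) d full c
        (supportedIn-full c)
        deg
        (λ x _ q∣∣x∣ → trans (evalML-c≡f x) (inIdeal⇒vanishes f f∈⟨¬χ⟩ x q∣∣x∣))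
        (subst (d * q <_) (sym (weight-full n)) dq<n)

    x₁-x₂-times-symmetric-vanishes : ∀ {m} (D : ℕ → Fp) →
      (∀ (r : Fin (suc m / q)) → binomialSum D (suc (toℕ r) * q ∸ 1) ≡ 0F) →
      ∀ x → q ∣ weight x → evalML (x₁-x₂-times-symmetric {m} D) x ≡ 0F
    x₁-x₂-times-symmetric-vanishes D D-kernel (x₁ ∷ x₂ ∷ y) q∣∣x∣ =
      trans (evalML-x₁-x₂-times-symmetric D x₁ x₂ y) (by-cases x₁ x₂ q∣∣x∣)
      where
      G = binomialSum D (weight y)
      G≡0 : q ∣ suc (weight y) → G ≡ 0F
      G≡0 q∣∣y∣+1 = let r , W[r]≡∣y∣ = predecessor-of-multiple q∣∣y∣+1 (weight≤n y) in
        subst (λ w → binomialSum D w ≡ 0F) W[r]≡∣y∣ (D-kernel r)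
      by-cases : ∀ x₁ x₂ → q ∣ weight (x₁ ∷ x₂ ∷ y) → [ x₁ ]· G +F [ x₂ ]· negF G ≡ 0F
      by-cases false false _     = +F-identityˡ 0F
      by-cases true  true  _     = negF-inverseʳ G
      by-cases true  false q∣∣x∣ = trans (+F-identityʳ G) (G≡0 q∣∣x∣)
      by-cases false true  q∣∣x∣ = trans (+F-identityˡ _) (trans (cong negF (G≡0 q∣∣x∣)) negF-0F)

    immunity-upper-bound : ∀ n → 1 ≤ n → Σ (R n) λ f →
      InIdeal (notChi q) f × Nonzero f × DegLE f (floorDiv (n + q ∸ 1) q hq)
    immunity-upper-bound 1 _ = evalML x₁ , vanishes⇒inIdeal (evalML x₁) x₁-vanishes , x₁≢0 ,
      subst (DegLE (evalML x₁)) (sym (n/n≡1 q)) (x₁ , x₁-degree , λ _ → refl)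
      where
      x₁ : Cube 1 → Fp
      x₁ (b ∷ []) = [ b ]· 1F
      x₁-vanishes : ∀ x → q ∣ weight x → evalML x₁ x ≡ 0F
      x₁-vanishes (false ∷ []) _   = +F-identityˡ 0F
      x₁-vanishes (true  ∷ []) q∣1 = ⊥-elim (ℕ.<⇒≱ hq (∣⇒≤ q∣1))
      x₁≢0 : Nonzero (evalML x₁)
      x₁≢0 x₁≡0 = 1F≢0F (trans (sym (+F-identityˡ 1F)) (x₁≡0 (true ∷ [])))
      x₁-degree : ∀ S → 1 < weight S → x₁ S ≡ 0F
      x₁-degree (false ∷ []) _         = refl
      x₁-degree (true  ∷ []) (s≤s ())
    immunity-upper-bound (suc (suc m)) _ =
      evalML c , vanishes⇒inIdeal (evalML c) (x₁-x₂-times-symmetric-vanishes D D-kernel) ,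
      x₁-x₂-times-symmetric-nonzero D j₀ (ℕ.≤-trans j₀≤K (ℕ.≤-pred (m/n<m (suc m) q hq))) D[j₀]≢0 ,
      subst (DegLE (evalML c)) (sym k≡K+1) (c , x₁-x₂-times-symmetric-degree K D D-high , λ _ → refl)
      where
      K = suc m / q
      open BinomialKernelVector (binomialSum-kernel K (λ r → suc (toℕ r) * q ∸ 1))
      c = x₁-x₂-times-symmetric D
      k≡K+1 : floorDiv (suc (suc m) + q ∸ 1) q hq ≡ suc K
      k≡K+1 = trans (+-distrib-/-∣ʳ (suc m) (∣-refl {q})) (trans (cong (K +_) (n/n≡1 q)) (ℕ.+-comm K 1))

    immunity : ∀ n → 1 ≤ n → ImmunityIs {n} (notChi q) (floorDiv (n + q ∸ 1) q hq)
    immunity n 1≤n = immunity-upper-bound n 1≤n , immunity-lower-bound n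

mainTheorem2 : (p : ℕ) (pr : Prime p) (q : ℕ) (hq : 2 ≤ q) → Coprime q p →
    (n : ℕ) → 1 ≤ n →
    Field.ImmunityIs p pr {n} (Field.notChi p pr q {n})
      (floorDiv (n + q ∸ 1) q hq)
mainTheorem2 p pr q hq cop n 1≤n = immunity p pr q hq cop n 1≤n
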